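{- Let $\mathcal C$ and $\mathcal D$ be combinatorial spheres with disjoint vertex sets. Then the join $\mathcal C*\mathcal D$ is a combinatorial sphere.
   Context: A simplicial complex is a finite nonempty collection of finite sets closed under subsets (so it contains $\emptyset$); $\dim\sigma=|\sigma|-1$; $\alpha$ is a facet of $\beta$ if $\alpha\subseteq\beta$ and $\dim\alpha=\dim\beta-1$. The join of two complexes with disjoint vertex sets is $\mathcal C*\mathcal D=\{\sigma\sqcup\tau:\sigma\in\mathcal C,\ \tau\in\mathcal D\}$. A discrete vector field $\mathcal V$ is a set of pairs $(\alpha,\beta)$ of simplices ($\alpha=\emptyset$ allowed) with $\alpha$ a facet of $\beta$, each simplex in at most one pair. A $\mathcal V$-trajectory is a sequence $\beta_0,\alpha_1,\beta_1,\dots,\alpha_r,\beta_r$ of alternately $q$- and $(q-1)$-simplices with $(\alpha_i,\beta_i)\in\mathcal V$, $\alpha_i\subsetneq\beta_{i-1}$, $\beta_{i-1}\ne\beta_i$; nontrivial closed if $r>0$ and $\beta_r=\beta_0$. A gradient vector field has no nontrivial closed trajectory. A nonempty simplex is critical if it lies in no pair, or is a $0$-simplex $\sigma$ with $(\emptyset,\sigma)\in\mathcal V$. A $d$-dimensional pseudomanifold is a simplicial complex whose maximal simplices all have dimension $d$, with every $(d-1)$-simplex in exactly two $d$-simplices, and any two $d$-simplices joined by a sequence of $d$-simplices in which consecutive ones meet in a $(d-1)$-simplex. A combinatorial $d$-sphere is a $d$-dimensional pseudomanifold admitting a gradient vector field with exactly two critical simplices, one $d$-dimensional and one $0$-dimensional.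 -}

module Defs where

open import Data.Nat using (ℕ; zero; suc; _<_; _≤?_)
open import Data.Nat.Properties using (_<?_)
open import Data.List using (List; []; _∷_; length; merge; concatMap; map)
open import Data.List.Membership.Propositional using (_∈_; _∉_)
open import Data.List.Relation.Binary.Subset.Propositional using (_⊆_)
open import Data.List.Relation.Unary.Linked using (Linked)
open import Data.Product using (Σ; ∃; _×_; _,_; proj₁; proj₂)
open import Data.Sum using (_⊎_)
open import Relation.Binary.PropositionalEquality using (_≡_; _≢_)
open import Relation.Nullary using (¬_)

-- A (finite) simplex is represented canonically
-- as a strictly increasing list of vertices, so that propositional equality of
-- lists is equality of sets, and the cardinality |σ| is  length σ .
-- dim σ = |σ| - 1, so "σ is a q-simplex" is written  length σ ≡ suc q .
Simplex : Set
Simplex = List ℕ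

-- A finite collection of simplices, given as a list (repetitions irrelevant;
-- only membership is ever used).
Complex : Set
Complex = List Simplex

record IsSimplicialComplex (K : Complex) : Set where
  field
    canonical : ∀ {σ} → σ ∈ K → Linked _<_ σ
    nonempty  : ∃ λ σ → σ ∈ K
    closed    : ∀ {σ τ} → σ ∈ K → Linked _<_ τ → τ ⊆ σ → τ ∈ K

_IsFacetOf_ : Simplex → Simplex → Set
α IsFacetOf β = (α ⊆ β) × (suc (length α) ≡ length β)

-- Join of complexes: { σ ⊔ τ : σ ∈ C, τ ∈ D } (the disjoint union of two
-- strictly increasing lists with disjoint entries is their merge).
join : Complex → Complex → Complex
join C D = concatMap (λ σ → map (λ τ → merge _<?_ σ τ) D) C

DisjointVertices : Complex → Complex → Set
DisjointVertices C D =
  ∀ {v σ τ} → σ ∈ C → τ ∈ D → v ∈ σ → v ∉ τ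

VectorField : Set
VectorField = List (Simplex × Simplex)

-- Discrete vector field on K (pairs of simplices of K, α = ∅ allowed).
record IsDiscreteVectorField (K : Complex) (V : VectorField) : Set where
  field
    pairsInK   : ∀ {α β} → (α , β) ∈ V → (α ∈ K) × (β ∈ K)
    pairsFacet : ∀ {α β} → (α , β) ∈ V → α IsFacetOf β
    atMostOne  : ∀ {p q σ} → p ∈ V → q ∈ V →
                 (σ ≡ proj₁ p ⊎ σ ≡ proj₂ p) → (σ ≡ proj₁ q ⊎ σ ≡ proj₂ q) →
                 p ≡ q

-- V-trajectories  β₀, α₁, β₁, …, α_r, β_r  (from β₀ to β_r), r ≥ 0.
-- Each step: (α_i , β_i) ∈ V, α_i ⊊ β_{i-1} with α_i a (q-1)-simplex and
-- β_{i-1} a q-simplex (forced: α_i facet of β_i and of β_{i-1}), β_{i-1} ≢ β_i.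
data Trajectory (V : VectorField) : Simplex → Simplex → Set where
  stop : ∀ β → Trajectory V β β
  step : ∀ {β₀ α β γ} → (α , β) ∈ V → α IsFacetOf β₀ → β₀ ≢ β →
         Trajectory V β γ → Trajectory V β₀ γ

data Trajectory⁺ (V : VectorField) : Simplex → Simplex → Set where
  step : ∀ {β₀ α β γ} → (α , β) ∈ V → α IsFacetOf β₀ → β₀ ≢ β →
         Trajectory V β γ → Trajectory⁺ V β₀ γ

IsGradient : VectorField → Set
IsGradient V = ∀ β → ¬ Trajectory⁺ V β β

Critical : Complex → VectorField → Simplex → Set
Critical K V σ =
  (σ ∈ K) × (σ ≢ []) ×
  ( (∀ {p} → p ∈ V → (σ ≢ proj₁ p) × (σ ≢ proj₂ p))
  ⊎ ((length σ ≡ 1) × (([] , σ) ∈ V)) )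

data StronglyConnected (K : Complex) (d : ℕ) : Simplex → Simplex → Set where
  here  : ∀ σ → StronglyConnected K d σ σ
  there : ∀ {σ γ τ} → γ ∈ K → length γ ≡ suc d →
          (∃ λ α → (α ∈ K) × (length α ≡ d) × (α ⊆ σ) × (α ⊆ γ)) →
          StronglyConnected K d γ τ → StronglyConnected K d σ τ

record IsPseudomanifold (K : Complex) (d : ℕ) : Set where
  field
    complex     : IsSimplicialComplex K
    pure        : ∀ {σ} → σ ∈ K → (∀ {τ} → τ ∈ K → σ ⊆ τ → τ ≡ σ) →
                  length σ ≡ suc d
    thin        : ∀ {α} → α ∈ K → length α ≡ d →
                  Σ Simplex λ β₁ → Σ Simplex λ β₂ →
                    (β₁ ∈ K) × (β₂ ∈ K) × (β₁ ≢ β₂) ×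
                    (length β₁ ≡ suc d) × (length β₂ ≡ suc d) ×
                    (α ⊆ β₁) × (α ⊆ β₂) ×
                    (∀ {β} → β ∈ K → length β ≡ suc d → α ⊆ β →
                      (β ≡ β₁) ⊎ (β ≡ β₂))
    connected   : ∀ {σ τ} → σ ∈ K → τ ∈ K → length σ ≡ suc d → length τ ≡ suc d →
                  StronglyConnected K d σ τ

record IsCombinatorialSphereOfDim (K : Complex) (d : ℕ) : Set where
  field
    pseudomanifold : IsPseudomanifold K d
    field'         : VectorField
    discrete       : IsDiscreteVectorField K field'
    gradient       : IsGradient field'
    top            : Simplex
    bottom         : Simplex
    topCrit        : Critical K field' top
    bottomCrit     : Critical K field' bottom
    topDim         : length top ≡ suc d
    bottomDim      : length bottom ≡ 1
    distinct       : top ≢ bottom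
    onlyTwo        : ∀ {σ} → Critical K field' σ → (σ ≡ top) ⊎ (σ ≡ bottom)

IsCombinatorialSphere : Complex → Set
IsCombinatorialSphere K = ∃ λ d → IsCombinatorialSphereOfDim K d

-- First normalise the gradient field of each sphere so that ∅ is matched with its critical vertex;
-- then the top simplex is the only unmatched simplex.  On C * D, match σ ⊔ τ along the C-pair of σ
-- when σ is not the top simplex t of C, and t ⊔ τ along the D-pair of τ.  The only unmatched simplex
-- is then the top simplex of the join, and ∅ = ∅ ⊔ ∅ is matched with the critical vertex of C.
-- Along a trajectory the C-part never shrinks and, once different from t, never becomes t again.
-- So a closed trajectory either keeps a C-part of constant size different from t, and projects to
-- a closed trajectory of C, or keeps C-part t throughout, and projects to a closed trajectory of D.
module Submission where

open import Data.Bool.Base using (true; false)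
open import Data.Empty using (⊥; ⊥-elim)
open import Data.List.Base using (List; []; _∷_; length; merge; filter; concat; concatMap; map; _++_)
open import Data.List.Properties using (length-++; ≡-dec)
open import Data.List.Membership.Propositional using (_∈_; _∉_; find; lose)
import Data.List.Membership.DecPropositional as DecMembership
open import Data.List.Membership.Propositional.Properties
  using ( ∈-++⁺ˡ; ∈-++⁺ʳ; ∈-++⁻; ∈-map⁺; ∈-map⁻; ∈-concat⁺′; ∈-concat⁻′
        ; ∈-concatMap⁺; ∈-concatMap⁻; ∈-filter⁺; ∈-filter⁻)
open import Data.List.Relation.Binary.Disjoint.Propositional using (Disjoint)
open import Data.List.Relation.Binary.Permutation.Propositional.Properties
  using (merge-↭; ∈-resp-↭; All-resp-↭; ↭-length)
open import Data.List.Relation.Binary.Permutation.Propositional using (↭-sym)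
open import Data.List.Relation.Binary.Pointwise using (Pointwise-≡⇒≡)
open import Data.List.Relation.Binary.Subset.Propositional using (_⊆_)
open import Data.List.Relation.Binary.Subset.Propositional.Properties using (⊆-trans; filter⁺′)
open import Data.List.Relation.Binary.Sublist.Propositional
  using (minimum; _∷_; _∷ʳ_) renaming (_⊆_ to _⊑_; ⊆-antisym to ⊑-antisym)
open import Data.List.Relation.Binary.Sublist.Heterogeneous.Properties using (length-mono-≤; toPointwise)
open import Data.List.Relation.Unary.All as All using (All; _∷_)
open import Data.List.Relation.Unary.All.Properties using (++⁺)
open import Data.List.Relation.Unary.AllPairs using (AllPairs; []; _∷_)
open import Data.List.Relation.Unary.Any using (here; there; any?)
open import Data.List.Relation.Unary.Linked as Linked using (Linked)
open import Data.List.Relation.Unary.Linked.Properties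
  using (Linked⇒All; Linked⇒AllPairs; AllPairs⇒Linked; filter⁺)
open import Data.Nat.Base using (ℕ; zero; suc; _+_; _≤_; _<_; _<ᵇ_; s≤s)
open import Data.Nat.ListAction using (sum)
open import Data.Nat.Properties
  using ( _≟_; _<?_; <ᵇ-reflects-<; <-cmp; <-trans; <-irrefl; <⇒≱; <⇒≤; <-≤-trans; ≤-refl; ≤-antisym
        ; ≤-reflexive; ≤-trans; ≤∧≢⇒<; ≮⇒≥; m≤n⇒m<n∨m≡n; suc-injective; 1+n≢0; m+n≡0⇒m≡0; m+n≡0⇒n≡0
        ; +-suc; +-monoʳ-≤; +-cancelˡ-≡; +-cancelʳ-≤; m≤m+n; m≤n+m)
open import Data.List.Membership.DecPropositional _≟_ using (_∈?_)
open import Data.List.Relation.Binary.Subset.DecPropositional _≟_ using (_⊆?_)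
open import Data.Product using (Σ; ∃; ∃₂; _×_; _,_; proj₁; proj₂)
open import Data.Product.Properties using () renaming (≡-dec to ≡-dec-×)
open import Data.Sum as Sum using (_⊎_; inj₁; inj₂; swap)
open import Function.Base using (id; _∘_)
open import Relation.Binary.Definitions using (tri<; tri≈; tri>)
open import Relation.Binary.PropositionalEquality
open import Relation.Nullary using (¬_; Dec; yes; no)
open import Relation.Nullary.Decidable using (_×-dec_; ¬?; decidable-stable)
open import Relation.Nullary.Reflects using (ofʸ; ofⁿ)
open import Relation.Unary.Properties using (∁?)

open import Defs

Increasing : List ℕ → Set
Increasing = Linked _<_

head<tail : ∀ {x xs} → Increasing (x ∷ xs) → All (x <_) xs
head<tail ixs with Linked⇒AllPairs <-trans ixs
... | x<xs ∷ _ = x<xs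

⊆-drop : ∀ {y xs ys} → All (y <_) xs → xs ⊆ y ∷ ys → xs ⊆ ys
⊆-drop y<xs xs⊆ z∈xs with xs⊆ z∈xs
... | here refl = ⊥-elim (<-irrefl refl (All.lookup y<xs z∈xs))
... | there z∈ys = z∈ys

⊆⇒⊑ : ∀ {xs ys} → Increasing xs → Increasing ys → xs ⊆ ys → xs ⊑ ys
⊆⇒⊑ {[]} {ys} _ _ _ = minimum ys
⊆⇒⊑ {x ∷ xs} {[]} _ _ xs⊆ with xs⊆ (here refl)
... | ()
⊆⇒⊑ {x ∷ xs} {y ∷ ys} ixs iys xs⊆ with <-cmp x y
... | tri< x<y _ _ = ⊥-elim (<-irrefl refl (All.lookup (Linked⇒All <-trans x<y iys) (xs⊆ (here refl))))
... | tri≈ _ refl _ = refl ∷ ⊆⇒⊑ (Linked.tail ixs) (Linked.tail iys) (⊆-drop (head<tail ixs) (xs⊆ ∘ there))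
... | tri> _ _ y<x = y ∷ʳ ⊆⇒⊑ ixs (Linked.tail iys) (⊆-drop (Linked⇒All <-trans y<x ixs) xs⊆)

module _ {xs ys : List ℕ} (ixs : Increasing xs) (iys : Increasing ys) where

  ⊆⇒length≤ : xs ⊆ ys → length xs ≤ length ys
  ⊆⇒length≤ = length-mono-≤ ∘ ⊆⇒⊑ ixs iys

  ⊆∧length≥⇒≡ : xs ⊆ ys → length ys ≤ length xs → xs ≡ ys
  ⊆∧length≥⇒≡ xs⊆ys ys≤xs =
    Pointwise-≡⇒≡ (toPointwise (≤-antisym (⊆⇒length≤ xs⊆ys) ys≤xs) (⊆⇒⊑ ixs iys xs⊆ys))

  ⊂⇒length< : xs ⊆ ys → xs ≢ ys → length xs < length ys
  ⊂⇒length< xs⊆ys xs≢ys = ≤∧≢⇒< (⊆⇒length≤ xs⊆ys) (xs≢ys ∘ ⊆∧length≥⇒≡ xs⊆ys ∘ ≤-reflexive ∘ sym)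

  ⊆-antisym : xs ⊆ ys → ys ⊆ xs → xs ≡ ys
  ⊆-antisym xs⊆ys ys⊆xs = ⊑-antisym (⊆⇒⊑ ixs iys xs⊆ys) (⊆⇒⊑ iys ixs ys⊆xs)

_⊔_ : List ℕ → List ℕ → List ℕ
xs ⊔ ys = merge _<?_ xs ys

module _ {z : ℕ} (xs ys : List ℕ) where

  ∈-⊔⁻ : z ∈ xs ⊔ ys → z ∈ xs ⊎ z ∈ ys
  ∈-⊔⁻ = ∈-++⁻ xs ∘ ∈-resp-↭ (merge-↭ _<?_ xs ys)

  ∈-⊔⁺ˡ : z ∈ xs → z ∈ xs ⊔ ys
  ∈-⊔⁺ˡ = ∈-resp-↭ (↭-sym (merge-↭ _<?_ xs ys)) ∘ ∈-++⁺ˡ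

  ∈-⊔⁺ʳ : z ∈ ys → z ∈ xs ⊔ ys
  ∈-⊔⁺ʳ = ∈-resp-↭ (↭-sym (merge-↭ _<?_ xs ys)) ∘ ∈-++⁺ʳ xs

length-⊔ : ∀ xs ys → length (xs ⊔ ys) ≡ length xs + length ys
length-⊔ xs ys = trans (↭-length (merge-↭ _<?_ xs ys)) (length-++ xs)

⊔-identityʳ : ∀ xs → xs ⊔ [] ≡ xs
⊔-identityʳ [] = refl
⊔-identityʳ (x ∷ xs) = refl

⊔-mono : ∀ {xs ys xs′ ys′} → xs ⊆ xs′ → ys ⊆ ys′ → xs ⊔ ys ⊆ xs′ ⊔ ys′
⊔-mono {xs} {ys} {xs′} {ys′} xs⊆ ys⊆ z∈ with ∈-⊔⁻ xs ys z∈
... | inj₁ z∈xs = ∈-⊔⁺ˡ xs′ ys′ (xs⊆ z∈xs)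
... | inj₂ z∈ys = ∈-⊔⁺ʳ xs′ ys′ (ys⊆ z∈ys)

⊔-monoˡ : ∀ {xs xs′} ys → xs ⊆ xs′ → xs ⊔ ys ⊆ xs′ ⊔ ys
⊔-monoˡ ys xs⊆ = ⊔-mono {ys = ys} {ys′ = ys} xs⊆ id

⊔-monoʳ : ∀ xs {ys ys′} → ys ⊆ ys′ → xs ⊔ ys ⊆ xs ⊔ ys′
⊔-monoʳ xs = ⊔-mono {xs = xs} {xs′ = xs} id

All-⊔⁺ : ∀ {P : ℕ → Set} {xs ys} → All P xs → All P ys → All P (xs ⊔ ys)
All-⊔⁺ {P} {xs} {ys} Pxs Pys = All-resp-↭ {P = P} (↭-sym (merge-↭ _<?_ xs ys)) (++⁺ Pxs Pys)

⊔-allPairs : ∀ {xs ys} → AllPairs _<_ xs → AllPairs _<_ ys → Disjoint xs ys → AllPairs _<_ (xs ⊔ ys)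
⊔-allPairs {[]} _ ys< _ = ys<
⊔-allPairs {_ ∷ _} {[]} xs< _ _ = xs<
-- Both recursive calls are made before the case split, where the termination checker accepts them.
⊔-allPairs {x ∷ xs} {y ∷ ys} (x<xs ∷ xs<) (y<ys ∷ ys<) disj
  with ⊔-allPairs xs< (y<ys ∷ ys<) (λ (v∈xs , v∈ys) → disj (there v∈xs , v∈ys))
     | ⊔-allPairs (x<xs ∷ xs<) ys< (λ (v∈xs , v∈ys) → disj (v∈xs , there v∈ys))
     | x <ᵇ y | <ᵇ-reflects-< x y
... | xs⊔yys< | _ | true | ofʸ x<y = All-⊔⁺ x<xs (x<y ∷ All.map (<-trans x<y) y<ys) ∷ xs⊔yys<
... | _ | xxs⊔ys< | false | ofⁿ x≮y = All-⊔⁺ (y<x ∷ All.map (<-trans y<x) x<xs) y<ys ∷ xxs⊔ys<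
  where
  y<x : y < x
  y<x = ≤∧≢⇒< (≮⇒≥ x≮y) (λ { refl → disj (here refl , here refl) })

⊔-increasing : ∀ {xs ys} → Increasing xs → Increasing ys → Disjoint xs ys → Increasing (xs ⊔ ys)
⊔-increasing ixs iys disj =
  AllPairs⇒Linked (⊔-allPairs (Linked⇒AllPairs <-trans ixs) (Linked⇒AllPairs <-trans iys) disj)

length≡0⇒≡[] : ∀ {xs : List ℕ} → length xs ≡ 0 → xs ≡ []
length≡0⇒≡[] {[]} _ = refl

facet-of-vertex : ∀ {α β} → length β ≡ 1 → α IsFacetOf β → α ≡ []
facet-of-vertex β-vertex (_ , α<β) = length≡0⇒≡[] (suc-injective (trans α<β β-vertex))

⊔-facetˡ : ∀ {α β} τ → α IsFacetOf β → (α ⊔ τ) IsFacetOf (β ⊔ τ)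
⊔-facetˡ {α} {β} τ (α⊆β , α<β) =
  ⊔-monoˡ τ α⊆β , trans (cong suc (length-⊔ α τ)) (trans (cong (_+ length τ) α<β) (sym (length-⊔ β τ)))

⊔-facetʳ : ∀ {α β} σ → α IsFacetOf β → (σ ⊔ α) IsFacetOf (σ ⊔ β)
⊔-facetʳ {α} {β} σ (α⊆β , α<β) =
  ⊔-monoʳ σ α⊆β ,
  trans (cong suc (length-⊔ σ α)) (trans (sym (+-suc (length σ) (length α)))
    (trans (cong (length σ +_) α<β) (sym (length-⊔ σ β))))

⊔≡[]⇒ˡ : ∀ σ τ → σ ⊔ τ ≡ [] → σ ≡ []
⊔≡[]⇒ˡ σ τ σ⊔τ≡[] = length≡0⇒≡[] (m+n≡0⇒m≡0 (length σ) (trans (sym (length-⊔ σ τ)) (cong length σ⊔τ≡[])))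

⊔≡[]⇒ʳ : ∀ σ τ → σ ⊔ τ ≡ [] → τ ≡ []
⊔≡[]⇒ʳ σ τ σ⊔τ≡[] = length≡0⇒≡[] (m+n≡0⇒n≡0 (length σ) (trans (sym (length-⊔ σ τ)) (cong length σ⊔τ≡[])))

length≡1+⇒≢[] : ∀ {σ : Simplex} {n} → length σ ≡ suc n → σ ≢ []
length≡1+⇒≢[] σ-length refl = 1+n≢0 (sym σ-length)

[]∈ : ∀ {K} → IsSimplicialComplex K → [] ∈ K
[]∈ K-complex = closed (proj₂ nonempty) Linked.[] (λ ())
  where open IsSimplicialComplex K-complex

Maximal : Complex → Simplex → Set
Maximal K σ = ∀ {τ} → τ ∈ K → σ ⊆ τ → τ ≡ σ

_≟ₛ_ : (σ τ : Simplex) → Dec (σ ≡ τ)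
_≟ₛ_ = ≡-dec _≟_

length≤sum-length : ∀ {K : Complex} {σ} → σ ∈ K → length σ ≤ sum (map length K)
length≤sum-length {σ ∷ _} (here refl) = m≤m+n (length σ) _
length≤sum-length {τ ∷ _} (there σ∈K) = ≤-trans (length≤sum-length σ∈K) (m≤n+m _ (length τ))

module _ {K : Complex} (K-increasing : ∀ {σ} → σ ∈ K → Increasing σ) where

  -- The fuel n bounds how often σ can still be enlarged, as no simplex is longer than all of K.
  extend-to-maximal : ∀ n {σ} → σ ∈ K → sum (map length K) ≤ n + length σ →
                      ∃ λ τ → τ ∈ K × σ ⊆ τ × Maximal K τ
  extend-to-maximal n {σ} σ∈K fuel with any? (λ τ → (σ ⊆? τ) ×-dec ¬? (τ ≟ₛ σ)) K
  ... | no ¬larger = σ , σ∈K , id , σ-maximal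
    where
    σ-maximal : Maximal K σ
    σ-maximal {τ} τ∈K σ⊆τ = decidable-stable (τ ≟ₛ σ) (λ τ≢σ → ¬larger (lose τ∈K (σ⊆τ , τ≢σ)))
  ... | yes larger with find larger
  ... | τ , τ∈K , σ⊆τ , τ≢σ = through n fuel
    where
    σ<τ : length σ < length τ
    σ<τ = ⊂⇒length< (K-increasing σ∈K) (K-increasing τ∈K) σ⊆τ (τ≢σ ∘ sym)
    through : ∀ n → sum (map length K) ≤ n + length σ → ∃ λ υ → υ ∈ K × σ ⊆ υ × Maximal K υ
    through zero fuel = ⊥-elim (<⇒≱ (≤-trans σ<τ (length≤sum-length τ∈K)) fuel)
    through (suc n) fuel with extend-to-maximal n τ∈K
      (≤-trans fuel (≤-trans (≤-reflexive (sym (+-suc n (length σ)))) (+-monoʳ-≤ n σ<τ)))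
    ... | υ , υ∈K , τ⊆υ , υ-maximal = υ , υ∈K , ⊆-trans σ⊆τ τ⊆υ , υ-maximal

  maximal-extension : ∀ {σ} → σ ∈ K → ∃ λ τ → τ ∈ K × σ ⊆ τ × Maximal K τ
  maximal-extension σ∈K = extend-to-maximal _ σ∈K (m≤m+n _ _)

pseudomanifold-length≤ : ∀ {K d σ} → IsPseudomanifold K d → σ ∈ K → length σ ≤ suc d
pseudomanifold-length≤ K-pm σ∈K =
  let τ , τ∈K , σ⊆τ , τ-maximal = maximal-extension canonical σ∈K
  in  ≤-trans (⊆⇒length≤ (canonical σ∈K) (canonical τ∈K) σ⊆τ) (≤-reflexive (pure τ∈K τ-maximal))
  where
  open IsPseudomanifold K-pm
  open IsSimplicialComplex complex

_∈ₚ_ : Simplex → Simplex × Simplex → Set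
σ ∈ₚ (α , β) = σ ≡ α ⊎ σ ≡ β

Unpaired : VectorField → Simplex → Set
Unpaired V σ = ∀ {p} → p ∈ V → (σ ≢ proj₁ p) × (σ ≢ proj₂ p)

unpaired⇒∉ₚ : ∀ {V σ p} → Unpaired V σ → p ∈ V → ¬ σ ∈ₚ p
unpaired⇒∉ₚ σ-unpaired p∈V (inj₁ σ≡α) = proj₁ (σ-unpaired p∈V) σ≡α
unpaired⇒∉ₚ σ-unpaired p∈V (inj₂ σ≡β) = proj₂ (σ-unpaired p∈V) σ≡β

critical⇒unpaired : ∀ {K V σ} → Critical K V σ → ([] , σ) ∉ V → Unpaired V σ
critical⇒unpaired (_ , _ , inj₁ σ-unpaired) _ = σ-unpaired
critical⇒unpaired (_ , _ , inj₂ (_ , σ-paired)) σ-unmatched = ⊥-elim (σ-unmatched σ-paired)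

∉ₚ⇒unpaired : ∀ {V σ} → (∀ {p} → p ∈ V → ¬ σ ∈ₚ p) → Unpaired V σ
∉ₚ⇒unpaired σ∉V p∈V = σ∉V p∈V ∘ inj₁ , σ∉V p∈V ∘ inj₂

record AugmentedSphere (K : Complex) (d : ℕ) : Set where
  field
    pseudomanifold : IsPseudomanifold K d
    V              : VectorField
    discrete       : IsDiscreteVectorField K V
    gradient       : IsGradient V
    top base       : Simplex
    top∈K          : top ∈ K
    top-length     : length top ≡ suc d
    top-unpaired   : Unpaired V top
    unpaired⇒top   : ∀ {σ} → σ ∈ K → Unpaired V σ → σ ≡ top
    base-paired    : ([] , base) ∈ V

augmentedSphere : ∀ {K d V t b} → IsPseudomanifold K d → IsDiscreteVectorField K V → IsGradient V →
                  Critical K V t → length t ≡ suc d → ([] , b) ∈ V → t ≢ b →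
                  (∀ {σ} → Critical K V σ → σ ≡ t ⊎ σ ≡ b) → AugmentedSphere K d
augmentedSphere {K} {d} {V} {t} {b} K-pm V-discrete V-gradient t-critical t-length b-paired t≢b only-t-b =
  record
    { pseudomanifold = K-pm ; V = V ; discrete = V-discrete ; gradient = V-gradient
    ; top = t ; base = b ; top∈K = proj₁ t-critical ; top-length = t-length
    ; top-unpaired = t-unpaired ; unpaired⇒top = unpaired⇒t ; base-paired = b-paired }
  where
  open IsDiscreteVectorField V-discrete
  t-unpaired : Unpaired V t
  t-unpaired = critical⇒unpaired t-critical λ t-paired →
    t≢b (cong proj₂ (atMostOne t-paired b-paired (inj₁ refl) (inj₁ refl)))
  unpaired⇒t : ∀ {σ} → σ ∈ K → Unpaired V σ → σ ≡ t
  unpaired⇒t σ∈K σ-unpaired with only-t-b (σ∈K , proj₁ (σ-unpaired b-paired) , inj₁ σ-unpaired)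
  ... | inj₁ σ≡t = σ≡t
  ... | inj₂ σ≡b = ⊥-elim (proj₂ (σ-unpaired b-paired) σ≡b)

module PairEmptyWith {K : Complex} {V : VectorField} {b : Simplex}
                     (∅-unpaired : Unpaired V []) (b-vertex : length b ≡ 1) where

  V⁺ : VectorField
  V⁺ = ([] , b) ∷ V

  discrete⁺ : IsSimplicialComplex K → IsDiscreteVectorField K V → b ∈ K → Unpaired V b →
              IsDiscreteVectorField K V⁺
  discrete⁺ K-complex V-discrete b∈K b-unpaired =
    record { pairsInK = pairsInK⁺ ; pairsFacet = pairsFacet⁺ ; atMostOne = atMostOne⁺ }
    where
    open IsDiscreteVectorField V-discrete
    pairsInK⁺ : ∀ {α β} → (α , β) ∈ V⁺ → (α ∈ K) × (β ∈ K)
    pairsInK⁺ (here refl) = []∈ K-complex , b∈K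
    pairsInK⁺ (there p∈V) = pairsInK p∈V
    pairsFacet⁺ : ∀ {α β} → (α , β) ∈ V⁺ → α IsFacetOf β
    pairsFacet⁺ (here refl) = (λ ()) , sym b-vertex
    pairsFacet⁺ (there p∈V) = pairsFacet p∈V
    new-unpaired : ∀ {σ p} → σ ∈ₚ ([] , b) → p ∈ V → ¬ σ ∈ₚ p
    new-unpaired (inj₁ refl) = unpaired⇒∉ₚ ∅-unpaired
    new-unpaired (inj₂ refl) = unpaired⇒∉ₚ b-unpaired
    atMostOne⁺ : ∀ {p q σ} → p ∈ V⁺ → q ∈ V⁺ → σ ∈ₚ p → σ ∈ₚ q → p ≡ q
    atMostOne⁺ (here refl) (here refl) _ _ = refl
    atMostOne⁺ (here refl) (there q∈V) σ∈p σ∈q = ⊥-elim (new-unpaired σ∈p q∈V σ∈q)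
    atMostOne⁺ (there p∈V) (here refl) σ∈p σ∈q = ⊥-elim (new-unpaired σ∈q p∈V σ∈p)
    atMostOne⁺ (there p∈V) (there q∈V) = atMostOne p∈V q∈V

  trajectory-from-b : ∀ {γ} → Trajectory V⁺ b γ → γ ≡ b
  trajectory-from-b (stop _) = refl
  trajectory-from-b (step _ α⊂b _ _) with facet-of-vertex b-vertex α⊂b
  trajectory-from-b (step (here refl) _ b≢b _) | refl = ⊥-elim (b≢b refl)
  trajectory-from-b (step (there ∅-paired) _ _ _) | refl = ⊥-elim (proj₁ (∅-unpaired ∅-paired) refl)

  trajectory⁻ : ∀ {β γ} → Trajectory V⁺ β γ → Trajectory V β γ ⊎ γ ≡ b
  trajectory⁻ (stop _) = inj₁ (stop _)
  trajectory⁻ (step (here refl) _ _ rest) = inj₂ (trajectory-from-b rest)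
  trajectory⁻ (step (there p∈V) α⊂β β≢β′ rest) with trajectory⁻ rest
  ... | inj₁ rest′ = inj₁ (step p∈V α⊂β β≢β′ rest′)
  ... | inj₂ γ≡b = inj₂ γ≡b

  gradient⁺ : IsGradient V → IsGradient V⁺
  gradient⁺ V-gradient β (step (here refl) _ β≢b rest) = β≢b (trajectory-from-b rest)
  gradient⁺ V-gradient β (step (there p∈V) α⊂β β≢β′ rest) with trajectory⁻ rest
  ... | inj₁ rest′ = V-gradient β (step p∈V α⊂β β≢β′ rest′)
  ... | inj₂ refl with facet-of-vertex b-vertex α⊂β
  ...   | refl = proj₁ (∅-unpaired p∈V) refl

  critical⁻ : ∀ {σ} → Unpaired V b → Critical K V⁺ σ → Critical K V σ
  critical⁻ _ (σ∈K , σ≢[] , inj₁ σ-unpaired) = σ∈K , σ≢[] , inj₁ (σ-unpaired ∘ there)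
  critical⁻ b-unpaired (b∈K , b≢[] , inj₂ (_ , here refl)) = b∈K , b≢[] , inj₁ b-unpaired
  critical⁻ _ (σ∈K , σ≢[] , inj₂ (σ-vertex , there σ-paired)) = σ∈K , σ≢[] , inj₂ (σ-vertex , σ-paired)

_∈ₛ?_ : (p : Simplex × Simplex) (V : VectorField) → Dec (p ∈ V)
_∈ₛ?_ = DecMembership._∈?_ (≡-dec-× _≟ₛ_ _≟ₛ_)

sphere⇒augmented : ∀ {K d} → IsCombinatorialSphereOfDim K d → AugmentedSphere K d
sphere⇒augmented {K} {d} S with ([] , top) ∈ₛ? field' | ([] , bottom) ∈ₛ? field'
  where open IsCombinatorialSphereOfDim S
... | yes top-paired | _ =
  -- then d = 0 and top and bottom trade places
  augmentedSphere pseudomanifold discrete gradient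
    bottomCrit bottom-length top-paired (distinct ∘ sym) (swap ∘ onlyTwo)
  where
  open IsCombinatorialSphereOfDim S
  bottom-length : length bottom ≡ suc d
  bottom-length = trans bottomDim (trans (proj₂ (pairsFacet top-paired)) topDim)
    where open IsDiscreteVectorField discrete
... | no _ | yes bottom-paired =
  augmentedSphere pseudomanifold discrete gradient topCrit topDim bottom-paired distinct onlyTwo
  where open IsCombinatorialSphereOfDim S
... | no top-unmatched | no bottom-unmatched =
  augmentedSphere pseudomanifold
    (discrete⁺ complex discrete (proj₁ bottomCrit) bottom-unpaired) (gradient⁺ gradient)
    top-critical⁺ topDim (here refl) distinct (onlyTwo ∘ critical⁻ bottom-unpaired)
  where
  open IsCombinatorialSphereOfDim S
  open IsPseudomanifold pseudomanifold using (complex)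
  open IsDiscreteVectorField discrete
  -- ∅ can only be matched with a critical vertex, i.e. with top or bottom
  ∅-unpaired : Unpaired field' []
  ∅-unpaired {α , β} p∈V = ∅≢α , ∅≢β
    where
    ∅≢β : [] ≢ β
    ∅≢β refl = 1+n≢0 (proj₂ (pairsFacet p∈V))
    ∅≢α : [] ≢ α
    ∅≢α refl with onlyTwo (proj₂ (pairsInK p∈V) , ∅≢β ∘ sym , inj₂ (sym (proj₂ (pairsFacet p∈V)) , p∈V))
    ... | inj₁ refl = top-unmatched p∈V
    ... | inj₂ refl = bottom-unmatched p∈V
  open PairEmptyWith {K} {field'} {bottom} ∅-unpaired bottomDim
  bottom-unpaired : Unpaired field' bottom
  bottom-unpaired = critical⇒unpaired bottomCrit bottom-unmatched
  top-critical⁺ : Critical K V⁺ top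
  top-critical⁺ = proj₁ topCrit , proj₁ (proj₂ topCrit) , inj₁ top-unpaired⁺
    where
    top-unpaired⁺ : Unpaired V⁺ top
    top-unpaired⁺ (here refl) = proj₁ (proj₂ topCrit) , distinct
    top-unpaired⁺ (there p∈V) = critical⇒unpaired topCrit top-unmatched p∈V

module Join {C D : Complex} (C-complex : IsSimplicialComplex C) (D-complex : IsSimplicialComplex D)
            (disjoint : DisjointVertices C D) where

  open IsSimplicialComplex C-complex public using () renaming (canonical to C-increasing)
  open IsSimplicialComplex D-complex public using () renaming (canonical to D-increasing)
  open IsSimplicialComplex C-complex using () renaming (closed to C-closed)
  open IsSimplicialComplex D-complex using () renaming (closed to D-closed)

  ∈-join⁺ : ∀ {σ τ} → σ ∈ C → τ ∈ D → σ ⊔ τ ∈ join C D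
  ∈-join⁺ {σ} σ∈C τ∈D = ∈-concatMap⁺ (λ σ → map (σ ⊔_) D) (lose σ∈C (∈-map⁺ (σ ⊔_) τ∈D))

  ∈-join⁻ : ∀ {ρ} → ρ ∈ join C D → ∃₂ λ σ τ → σ ∈ C × τ ∈ D × ρ ≡ σ ⊔ τ
  ∈-join⁻ ρ∈J with find (∈-concatMap⁻ (λ σ → map (σ ⊔_) D) {xs = C} ρ∈J)
  ... | σ , σ∈C , ρ∈σ⊔D with ∈-map⁻ (σ ⊔_) ρ∈σ⊔D
  ...   | τ , τ∈D , ρ≡σ⊔τ = σ , τ , σ∈C , τ∈D , ρ≡σ⊔τ

  ∉C : ∀ {v τ} → τ ∈ D → v ∈ τ → v ∉ concat C
  ∉C τ∈D v∈τ v∈C = let σ , v∈σ , σ∈C = ∈-concat⁻′ C v∈C in disjoint σ∈C τ∈D v∈σ v∈τ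

  ⊔-increasing-CD : ∀ {σ τ} → σ ∈ C → τ ∈ D → Increasing (σ ⊔ τ)
  ⊔-increasing-CD σ∈C τ∈D =
    ⊔-increasing (C-increasing σ∈C) (D-increasing τ∈D) (λ (v∈σ , v∈τ) → disjoint σ∈C τ∈D v∈σ v∈τ)

  inC? : ∀ v → Dec (v ∈ concat C)
  inC? v = v ∈? concat C

  πᶜ πᵈ : Simplex → Simplex
  πᶜ = filter inC?
  πᵈ = filter (∁? inC?)

  πᶜ-increasing : ∀ {ρ} → Increasing ρ → Increasing (πᶜ ρ)
  πᶜ-increasing = filter⁺ inC? <-trans

  πᵈ-increasing : ∀ {ρ} → Increasing ρ → Increasing (πᵈ ρ)
  πᵈ-increasing = filter⁺ (∁? inC?) <-trans

  πᶜ-mono : ∀ {α ρ} → α ⊆ ρ → πᶜ α ⊆ πᶜ ρ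
  πᶜ-mono = filter⁺′ inC? inC? id

  πᵈ-mono : ∀ {α ρ} → α ⊆ ρ → πᵈ α ⊆ πᵈ ρ
  πᵈ-mono = filter⁺′ (∁? inC?) (∁? inC?) id

  πᶜ⊔πᵈ : ∀ {ρ} → Increasing ρ → πᶜ ρ ⊔ πᵈ ρ ≡ ρ
  πᶜ⊔πᵈ {ρ} ρ-increasing =
    ⊆-antisym (⊔-increasing (πᶜ-increasing ρ-increasing) (πᵈ-increasing ρ-increasing) parts-disjoint)
      ρ-increasing ⊔⊆ρ ρ⊆⊔
    where
    parts-disjoint : Disjoint (πᶜ ρ) (πᵈ ρ)
    parts-disjoint (v∈πᶜ , v∈πᵈ) =
      proj₂ (∈-filter⁻ (∁? inC?) {xs = ρ} v∈πᵈ) (proj₂ (∈-filter⁻ inC? {xs = ρ} v∈πᶜ))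
    ⊔⊆ρ : πᶜ ρ ⊔ πᵈ ρ ⊆ ρ
    ⊔⊆ρ v∈ with ∈-⊔⁻ (πᶜ ρ) (πᵈ ρ) v∈
    ... | inj₁ v∈πᶜ = proj₁ (∈-filter⁻ inC? v∈πᶜ)
    ... | inj₂ v∈πᵈ = proj₁ (∈-filter⁻ (∁? inC?) v∈πᵈ)
    ρ⊆⊔ : ρ ⊆ πᶜ ρ ⊔ πᵈ ρ
    ρ⊆⊔ {v} v∈ρ with inC? v
    ... | yes v∈C = ∈-⊔⁺ˡ (πᶜ ρ) (πᵈ ρ) (∈-filter⁺ inC? v∈ρ v∈C)
    ... | no v∉C = ∈-⊔⁺ʳ (πᶜ ρ) (πᵈ ρ) (∈-filter⁺ (∁? inC?) v∈ρ v∉C)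

  length-π : ∀ {ρ} → Increasing ρ → length ρ ≡ length (πᶜ ρ) + length (πᵈ ρ)
  length-π {ρ} ρ-increasing = trans (cong length (sym (πᶜ⊔πᵈ ρ-increasing))) (length-⊔ (πᶜ ρ) (πᵈ ρ))

  πᶜ-⊔ : ∀ {σ τ} → σ ∈ C → τ ∈ D → πᶜ (σ ⊔ τ) ≡ σ
  πᶜ-⊔ {σ} {τ} σ∈C τ∈D = ⊆-antisym (πᶜ-increasing (⊔-increasing-CD σ∈C τ∈D)) (C-increasing σ∈C) πᶜ⊆σ σ⊆πᶜ
    where
    πᶜ⊆σ : πᶜ (σ ⊔ τ) ⊆ σ
    πᶜ⊆σ v∈ with ∈-filter⁻ inC? v∈
    ... | v∈σ⊔τ , v∈C with ∈-⊔⁻ σ τ v∈σ⊔τ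
    ...   | inj₁ v∈σ = v∈σ
    ...   | inj₂ v∈τ = ⊥-elim (∉C τ∈D v∈τ v∈C)
    σ⊆πᶜ : σ ⊆ πᶜ (σ ⊔ τ)
    σ⊆πᶜ v∈σ = ∈-filter⁺ inC? (∈-⊔⁺ˡ σ τ v∈σ) (∈-concat⁺′ v∈σ σ∈C)

  πᵈ-⊔ : ∀ {σ τ} → σ ∈ C → τ ∈ D → πᵈ (σ ⊔ τ) ≡ τ
  πᵈ-⊔ {σ} {τ} σ∈C τ∈D = ⊆-antisym (πᵈ-increasing (⊔-increasing-CD σ∈C τ∈D)) (D-increasing τ∈D) πᵈ⊆τ τ⊆πᵈ
    where
    πᵈ⊆τ : πᵈ (σ ⊔ τ) ⊆ τ
    πᵈ⊆τ v∈ with ∈-filter⁻ (∁? inC?) v∈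
    ... | v∈σ⊔τ , v∉C with ∈-⊔⁻ σ τ v∈σ⊔τ
    ...   | inj₁ v∈σ = ⊥-elim (v∉C (∈-concat⁺′ v∈σ σ∈C))
    ...   | inj₂ v∈τ = v∈τ
    τ⊆πᵈ : τ ⊆ πᵈ (σ ⊔ τ)
    τ⊆πᵈ v∈τ = ∈-filter⁺ (∁? inC?) (∈-⊔⁺ʳ σ τ v∈τ) (∉C τ∈D v∈τ)

  join-increasing : ∀ {ρ} → ρ ∈ join C D → Increasing ρ
  join-increasing ρ∈J with ∈-join⁻ ρ∈J
  ... | _ , _ , σ∈C , τ∈D , refl = ⊔-increasing-CD σ∈C τ∈D

  πᶜ∈C : ∀ {ρ} → ρ ∈ join C D → πᶜ ρ ∈ C
  πᶜ∈C ρ∈J with ∈-join⁻ ρ∈J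
  ... | _ , _ , σ∈C , τ∈D , refl = subst (_∈ C) (sym (πᶜ-⊔ σ∈C τ∈D)) σ∈C

  πᵈ∈D : ∀ {ρ} → ρ ∈ join C D → πᵈ ρ ∈ D
  πᵈ∈D ρ∈J with ∈-join⁻ ρ∈J
  ... | _ , _ , σ∈C , τ∈D , refl = subst (_∈ D) (sym (πᵈ-⊔ σ∈C τ∈D)) τ∈D

  join-split : ∀ {ρ} → ρ ∈ join C D → ρ ≡ πᶜ ρ ⊔ πᵈ ρ
  join-split = sym ∘ πᶜ⊔πᵈ ∘ join-increasing

  join-≡ : ∀ {ρ σ τ} → ρ ∈ join C D → πᶜ ρ ≡ σ → πᵈ ρ ≡ τ → ρ ≡ σ ⊔ τ
  join-≡ ρ∈J πᶜρ≡σ πᵈρ≡τ = trans (join-split ρ∈J) (cong₂ _⊔_ πᶜρ≡σ πᵈρ≡τ)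

  ⊔-injective : ∀ {σ τ σ′ τ′} → σ ∈ C → τ ∈ D → σ′ ∈ C → τ′ ∈ D → σ ⊔ τ ≡ σ′ ⊔ τ′ → σ ≡ σ′ × τ ≡ τ′
  ⊔-injective σ∈C τ∈D σ′∈C τ′∈D eq =
    trans (sym (πᶜ-⊔ σ∈C τ∈D)) (trans (cong πᶜ eq) (πᶜ-⊔ σ′∈C τ′∈D)) ,
    trans (sym (πᵈ-⊔ σ∈C τ∈D)) (trans (cong πᵈ eq) (πᵈ-⊔ σ′∈C τ′∈D))

  join-length : ∀ {ρ} → ρ ∈ join C D → length ρ ≡ length (πᶜ ρ) + length (πᵈ ρ)
  join-length = length-π ∘ join-increasing

  join-complex : IsSimplicialComplex (join C D)
  join-complex = record
    { canonical = join-increasing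
    ; nonempty  = [] , ∈-join⁺ ([]∈ C-complex) ([]∈ D-complex)
    ; closed    = λ ρ∈J α-increasing α⊆ρ → subst (_∈ join C D) (πᶜ⊔πᵈ α-increasing)
        (∈-join⁺ (C-closed (πᶜ∈C ρ∈J) (πᶜ-increasing α-increasing) (πᶜ-mono α⊆ρ))
                 (D-closed (πᵈ∈D ρ∈J) (πᵈ-increasing α-increasing) (πᵈ-mono α⊆ρ)))
    }

bounded-sum-tight : ∀ {m n p q} → m ≤ p → n ≤ q → m + n ≡ p + q → m ≡ p × n ≡ q
bounded-sum-tight {m} {n} {p} {q} m≤p n≤q m+n≡p+q =
  m≡p , +-cancelˡ-≡ p n q (trans (cong (_+ n) (sym m≡p)) m+n≡p+q)
  where
  m≡p : m ≡ p
  m≡p = ≤-antisym m≤p (+-cancelʳ-≤ q p m (≤-trans (≤-reflexive (sym m+n≡p+q)) (+-monoʳ-≤ m n≤q)))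

bounded-sum-one-short : ∀ {m n p q} → m ≤ suc p → n ≤ suc q → m + n ≡ suc (p + q) →
                        (m ≡ suc p × n ≡ q) ⊎ (m ≡ p × n ≡ suc q)
bounded-sum-one-short {m} {n} {p} {q} m≤1+p n≤1+q m+n≡1+p+q with m≤n⇒m<n∨m≡n m≤1+p
... | inj₂ refl = inj₁ (refl , +-cancelˡ-≡ (suc p) n q m+n≡1+p+q)
... | inj₁ (s≤s m≤p) = inj₂ (bounded-sum-tight m≤p n≤1+q (trans m+n≡1+p+q (sym (+-suc p q))))

length-⊔-≡ : ∀ {σ τ m n} → length σ ≡ m → length τ ≡ n → length (σ ⊔ τ) ≡ m + n
length-⊔-≡ {σ} {τ} σ-length τ-length = trans (length-⊔ σ τ) (cong₂ _+_ σ-length τ-length)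

StronglyConnected-trans : ∀ {K d σ τ υ} → StronglyConnected K d σ τ → StronglyConnected K d τ υ →
                          StronglyConnected K d σ υ
StronglyConnected-trans (here _) τ~υ = τ~υ
StronglyConnected-trans (there γ∈K γ-length shared γ~τ) τ~υ =
  there γ∈K γ-length shared (StronglyConnected-trans γ~τ τ~υ)

ThinAt : Complex → ℕ → Simplex → Set
ThinAt K d α =
  Σ Simplex λ β₁ → Σ Simplex λ β₂ →
    (β₁ ∈ K) × (β₂ ∈ K) × (β₁ ≢ β₂) ×
    (length β₁ ≡ suc d) × (length β₂ ≡ suc d) ×
    (α ⊆ β₁) × (α ⊆ β₂) ×
    (∀ {β} → β ∈ K → length β ≡ suc d → α ⊆ β → (β ≡ β₁) ⊎ (β ≡ β₂))

module JoinPseudomanifold {C D : Complex} {p q : ℕ}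
                          (C-pm : IsPseudomanifold C p) (D-pm : IsPseudomanifold D q)
                          (disjoint : DisjointVertices C D) where

  private
    module PC = IsPseudomanifold C-pm
    module PD = IsPseudomanifold D-pm

  open Join PC.complex PD.complex disjoint public

  πᶜ-length≤ : ∀ {ρ} → ρ ∈ join C D → length (πᶜ ρ) ≤ suc p
  πᶜ-length≤ = pseudomanifold-length≤ C-pm ∘ πᶜ∈C

  πᵈ-length≤ : ∀ {ρ} → ρ ∈ join C D → length (πᵈ ρ) ≤ suc q
  πᵈ-length≤ = pseudomanifold-length≤ D-pm ∘ πᵈ∈D

  top-length-+ : ∀ {m n} → m ≡ suc p → n ≡ suc q → m + n ≡ suc (suc (p + q))
  top-length-+ refl refl = cong suc (+-suc p q)

  length-⊔-top : ∀ σ τ → length σ ≡ suc p → length τ ≡ suc q → length (σ ⊔ τ) ≡ suc (suc (p + q))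
  length-⊔-top σ τ σ-length τ-length = trans (length-⊔ σ τ) (top-length-+ σ-length τ-length)

  top-split : ∀ {ρ} → ρ ∈ join C D → length ρ ≡ suc (suc (p + q)) →
              length (πᶜ ρ) ≡ suc p × length (πᵈ ρ) ≡ suc q
  top-split ρ∈J ρ-length = bounded-sum-tight (πᶜ-length≤ ρ∈J) (πᵈ-length≤ ρ∈J)
    (trans (sym (join-length ρ∈J)) (trans ρ-length (sym (cong suc (+-suc p q)))))

  top⊆πᶜ⇒≡ : ∀ {ρ σ} → ρ ∈ join C D → σ ∈ C → length σ ≡ suc p → σ ⊆ πᶜ ρ → σ ≡ πᶜ ρ
  top⊆πᶜ⇒≡ ρ∈J σ∈C σ-length σ⊆πᶜρ = ⊆∧length≥⇒≡ (C-increasing σ∈C) (C-increasing (πᶜ∈C ρ∈J)) σ⊆πᶜρ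
    (≤-trans (πᶜ-length≤ ρ∈J) (≤-reflexive (sym σ-length)))

  top⊆πᵈ⇒≡ : ∀ {ρ τ} → ρ ∈ join C D → τ ∈ D → length τ ≡ suc q → τ ⊆ πᵈ ρ → τ ≡ πᵈ ρ
  top⊆πᵈ⇒≡ ρ∈J τ∈D τ-length τ⊆πᵈρ = ⊆∧length≥⇒≡ (D-increasing τ∈D) (D-increasing (πᵈ∈D ρ∈J)) τ⊆πᵈρ
    (≤-trans (πᵈ-length≤ ρ∈J) (≤-reflexive (sym τ-length)))

  πᶜ-maximal : ∀ {ρ} → ρ ∈ join C D → Maximal (join C D) ρ → Maximal C (πᶜ ρ)
  πᶜ-maximal {ρ} ρ∈J ρ-maximal {σ} σ∈C πᶜρ⊆σ = begin
    σ              ≡⟨ πᶜ-⊔ σ∈C (πᵈ∈D ρ∈J) ⟨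
    πᶜ (σ ⊔ πᵈ ρ)  ≡⟨ cong πᶜ (ρ-maximal (∈-join⁺ σ∈C (πᵈ∈D ρ∈J)) ρ⊆σ⊔πᵈρ) ⟩
    πᶜ ρ           ∎
    where
    open ≡-Reasoning
    ρ⊆σ⊔πᵈρ : ρ ⊆ σ ⊔ πᵈ ρ
    ρ⊆σ⊔πᵈρ = subst (_⊆ σ ⊔ πᵈ ρ) (sym (join-split ρ∈J)) (⊔-monoˡ (πᵈ ρ) πᶜρ⊆σ)

  πᵈ-maximal : ∀ {ρ} → ρ ∈ join C D → Maximal (join C D) ρ → Maximal D (πᵈ ρ)
  πᵈ-maximal {ρ} ρ∈J ρ-maximal {τ} τ∈D πᵈρ⊆τ = begin
    τ              ≡⟨ πᵈ-⊔ (πᶜ∈C ρ∈J) τ∈D ⟨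
    πᵈ (πᶜ ρ ⊔ τ)  ≡⟨ cong πᵈ (ρ-maximal (∈-join⁺ (πᶜ∈C ρ∈J) τ∈D) ρ⊆πᶜρ⊔τ) ⟩
    πᵈ ρ           ∎
    where
    open ≡-Reasoning
    ρ⊆πᶜρ⊔τ : ρ ⊆ πᶜ ρ ⊔ τ
    ρ⊆πᶜρ⊔τ = subst (_⊆ πᶜ ρ ⊔ τ) (sym (join-split ρ∈J)) (⊔-monoʳ (πᶜ ρ) πᵈρ⊆τ)

  join-pure : ∀ {ρ} → ρ ∈ join C D → Maximal (join C D) ρ → length ρ ≡ suc (suc (p + q))
  join-pure ρ∈J ρ-maximal = trans (join-length ρ∈J)
    (top-length-+ (PC.pure (πᶜ∈C ρ∈J) (πᶜ-maximal ρ∈J ρ-maximal))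
                  (PD.pure (πᵈ∈D ρ∈J) (πᵈ-maximal ρ∈J ρ-maximal)))

  thin-via-D : ∀ {α} → α ∈ join C D → length (πᶜ α) ≡ suc p → ThinAt D q (πᵈ α) →
               ThinAt (join C D) (suc (p + q)) α
  thin-via-D {α} α∈J σ-length
    (τ₁ , τ₂ , τ₁∈D , τ₂∈D , τ₁≢τ₂ , τ₁-length , τ₂-length , πᵈα⊆τ₁ , πᵈα⊆τ₂ , only-τ₁-τ₂) =
    σ ⊔ τ₁ , σ ⊔ τ₂ , ∈-join⁺ σ∈C τ₁∈D , ∈-join⁺ σ∈C τ₂∈D ,
    (λ eq → τ₁≢τ₂ (proj₂ (⊔-injective σ∈C τ₁∈D σ∈C τ₂∈D eq))) ,
    length-⊔-top σ τ₁ σ-length τ₁-length , length-⊔-top σ τ₂ σ-length τ₂-length ,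
    α⊆σ⊔ πᵈα⊆τ₁ , α⊆σ⊔ πᵈα⊆τ₂ , only
    where
    σ = πᶜ α
    σ∈C = πᶜ∈C α∈J
    α⊆σ⊔ : ∀ {τ} → πᵈ α ⊆ τ → α ⊆ σ ⊔ τ
    α⊆σ⊔ {τ} πᵈα⊆τ = subst (_⊆ σ ⊔ τ) (sym (join-split α∈J)) (⊔-monoʳ σ πᵈα⊆τ)
    only : ∀ {β} → β ∈ join C D → length β ≡ suc (suc (p + q)) → α ⊆ β → β ≡ σ ⊔ τ₁ ⊎ β ≡ σ ⊔ τ₂
    only {β} β∈J β-length α⊆β =
      Sum.map (join-≡ β∈J πᶜβ≡σ) (join-≡ β∈J πᶜβ≡σ)
        (only-τ₁-τ₂ (πᵈ∈D β∈J) (proj₂ (top-split β∈J β-length)) (πᵈ-mono α⊆β))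
      where
      πᶜβ≡σ : πᶜ β ≡ σ
      πᶜβ≡σ = sym (top⊆πᶜ⇒≡ β∈J σ∈C σ-length (πᶜ-mono α⊆β))

  thin-via-C : ∀ {α} → α ∈ join C D → length (πᵈ α) ≡ suc q → ThinAt C p (πᶜ α) →
               ThinAt (join C D) (suc (p + q)) α
  thin-via-C {α} α∈J τ-length
    (σ₁ , σ₂ , σ₁∈C , σ₂∈C , σ₁≢σ₂ , σ₁-length , σ₂-length , πᶜα⊆σ₁ , πᶜα⊆σ₂ , only-σ₁-σ₂) =
    σ₁ ⊔ τ , σ₂ ⊔ τ , ∈-join⁺ σ₁∈C τ∈D , ∈-join⁺ σ₂∈C τ∈D ,
    (λ eq → σ₁≢σ₂ (proj₁ (⊔-injective σ₁∈C τ∈D σ₂∈C τ∈D eq))) ,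
    length-⊔-top σ₁ τ σ₁-length τ-length , length-⊔-top σ₂ τ σ₂-length τ-length ,
    α⊆⊔τ πᶜα⊆σ₁ , α⊆⊔τ πᶜα⊆σ₂ , only
    where
    τ = πᵈ α
    τ∈D = πᵈ∈D α∈J
    α⊆⊔τ : ∀ {σ} → πᶜ α ⊆ σ → α ⊆ σ ⊔ τ
    α⊆⊔τ {σ} πᶜα⊆σ = subst (_⊆ σ ⊔ τ) (sym (join-split α∈J)) (⊔-monoˡ τ πᶜα⊆σ)
    only : ∀ {β} → β ∈ join C D → length β ≡ suc (suc (p + q)) → α ⊆ β → β ≡ σ₁ ⊔ τ ⊎ β ≡ σ₂ ⊔ τ
    only {β} β∈J β-length α⊆β =
      Sum.map (λ πᶜβ≡σ₁ → join-≡ β∈J πᶜβ≡σ₁ πᵈβ≡τ) (λ πᶜβ≡σ₂ → join-≡ β∈J πᶜβ≡σ₂ πᵈβ≡τ)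
        (only-σ₁-σ₂ (πᶜ∈C β∈J) (proj₁ (top-split β∈J β-length)) (πᶜ-mono α⊆β))
      where
      πᵈβ≡τ : πᵈ β ≡ τ
      πᵈβ≡τ = sym (top⊆πᵈ⇒≡ β∈J τ∈D τ-length (πᵈ-mono α⊆β))

  join-thin : ∀ {α} → α ∈ join C D → length α ≡ suc (p + q) → ThinAt (join C D) (suc (p + q)) α
  join-thin α∈J α-length
    with bounded-sum-one-short (πᶜ-length≤ α∈J) (πᵈ-length≤ α∈J) (trans (sym (join-length α∈J)) α-length)
  ... | inj₁ (σ-length , τ-length) = thin-via-D α∈J σ-length (PD.thin (πᵈ∈D α∈J) τ-length)
  ... | inj₂ (σ-length , τ-length) = thin-via-C α∈J τ-length (PC.thin (πᶜ∈C α∈J) σ-length)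

  connected-via-C : ∀ {σ σ′ τ} → StronglyConnected C p σ σ′ → τ ∈ D → length τ ≡ suc q →
                    StronglyConnected (join C D) (suc (p + q)) (σ ⊔ τ) (σ′ ⊔ τ)
  connected-via-C (here _) _ _ = here _
  connected-via-C {τ = τ} (there {γ = γ} γ∈C γ-length (ε , ε∈C , ε-length , ε⊆σ , ε⊆γ) γ~σ′)
                  τ∈D τ-length =
    there (∈-join⁺ γ∈C τ∈D) (length-⊔-top γ τ γ-length τ-length)
      (ε ⊔ τ , ∈-join⁺ ε∈C τ∈D , trans (length-⊔-≡ {ε} {τ} ε-length τ-length) (+-suc p q) ,
       ⊔-monoˡ τ ε⊆σ , ⊔-monoˡ τ ε⊆γ)
      (connected-via-C γ~σ′ τ∈D τ-length)

  connected-via-D : ∀ {σ τ τ′} → StronglyConnected D q τ τ′ → σ ∈ C → length σ ≡ suc p →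
                    StronglyConnected (join C D) (suc (p + q)) (σ ⊔ τ) (σ ⊔ τ′)
  connected-via-D (here _) _ _ = here _
  connected-via-D {σ = σ} (there {γ = γ} γ∈D γ-length (ε , ε∈D , ε-length , ε⊆τ , ε⊆γ) γ~τ′)
                  σ∈C σ-length =
    there (∈-join⁺ σ∈C γ∈D) (length-⊔-top σ γ σ-length γ-length)
      (σ ⊔ ε , ∈-join⁺ σ∈C ε∈D , length-⊔-≡ {σ} {ε} σ-length ε-length ,
       ⊔-monoʳ σ ε⊆τ , ⊔-monoʳ σ ε⊆γ)
      (connected-via-D γ~τ′ σ∈C σ-length)

  join-connected : ∀ {ρ ρ′} → ρ ∈ join C D → ρ′ ∈ join C D →
                   length ρ ≡ suc (suc (p + q)) → length ρ′ ≡ suc (suc (p + q)) →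
                   StronglyConnected (join C D) (suc (p + q)) ρ ρ′
  join-connected {ρ} {ρ′} ρ∈J ρ′∈J ρ-length ρ′-length =
    subst₂ (StronglyConnected (join C D) (suc (p + q))) (sym (join-split ρ∈J)) (sym (join-split ρ′∈J))
      (StronglyConnected-trans
        (connected-via-C (PC.connected (πᶜ∈C ρ∈J) (πᶜ∈C ρ′∈J) σ-length σ′-length) (πᵈ∈D ρ∈J) τ-length)
        (connected-via-D (PD.connected (πᵈ∈D ρ∈J) (πᵈ∈D ρ′∈J) τ-length τ′-length) (πᶜ∈C ρ′∈J) σ′-length))
    where
    σ-length = proj₁ (top-split ρ∈J ρ-length)
    τ-length = proj₂ (top-split ρ∈J ρ-length)
    σ′-length = proj₁ (top-split ρ′∈J ρ′-length)
    τ′-length = proj₂ (top-split ρ′∈J ρ′-length)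

  join-pseudomanifold : IsPseudomanifold (join C D) (suc (p + q))
  join-pseudomanifold = record
    { complex = join-complex ; pure = join-pure ; thin = join-thin ; connected = join-connected }

module JoinField {C D : Complex} {p q : ℕ} (SC : AugmentedSphere C p) (SD : AugmentedSphere D q)
                 (disjoint : DisjointVertices C D) where

  private
    module SC = AugmentedSphere SC
    module SD = AugmentedSphere SD
    module VC = IsDiscreteVectorField SC.discrete
    module VD = IsDiscreteVectorField SD.discrete

  open JoinPseudomanifold SC.pseudomanifold SD.pseudomanifold disjoint

  joinᶜ : Simplex × Simplex → List (Simplex × Simplex)
  joinᶜ (α , β) = map (λ τ → α ⊔ τ , β ⊔ τ) D

  joinᵈ : Simplex × Simplex → Simplex × Simplex
  joinᵈ (α , β) = SC.top ⊔ α , SC.top ⊔ β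

  W : VectorField
  W = concatMap joinᶜ SC.V ++ map joinᵈ SD.V

  data WPair : Simplex × Simplex → Set where
    from-C : ∀ {α β τ} → (α , β) ∈ SC.V → τ ∈ D → WPair (α ⊔ τ , β ⊔ τ)
    from-D : ∀ {α β} → (α , β) ∈ SD.V → WPair (SC.top ⊔ α , SC.top ⊔ β)

  W-pair : ∀ {w} → w ∈ W → WPair w
  W-pair w∈W with ∈-++⁻ (concatMap joinᶜ SC.V) w∈W
  ... | inj₁ w∈W₁ with find (∈-concatMap⁻ joinᶜ {xs = SC.V} w∈W₁)
  ...   | (α , β) , αβ∈V , w∈αβ⊔D with ∈-map⁻ (λ τ → α ⊔ τ , β ⊔ τ) w∈αβ⊔D
  ...     | τ , τ∈D , refl = from-C αβ∈V τ∈D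
  W-pair w∈W | inj₂ w∈W₂ with ∈-map⁻ joinᵈ w∈W₂
  ... | (α , β) , αβ∈V , refl = from-D αβ∈V

  from-C∈W : ∀ {α β τ} → (α , β) ∈ SC.V → τ ∈ D → (α ⊔ τ , β ⊔ τ) ∈ W
  from-C∈W {α} {β} αβ∈V τ∈D =
    ∈-++⁺ˡ (∈-concatMap⁺ joinᶜ (lose αβ∈V (∈-map⁺ (λ τ → α ⊔ τ , β ⊔ τ) τ∈D)))

  from-D∈W : ∀ {α β} → (α , β) ∈ SD.V → (SC.top ⊔ α , SC.top ⊔ β) ∈ W
  from-D∈W αβ∈V = ∈-++⁺ʳ (concatMap joinᶜ SC.V) (∈-map⁺ joinᵈ αβ∈V)

  WPair-∈J : ∀ {α β} → WPair (α , β) → (α ∈ join C D) × (β ∈ join C D)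
  WPair-∈J (from-C αβ∈V τ∈D) =
    ∈-join⁺ (proj₁ (VC.pairsInK αβ∈V)) τ∈D , ∈-join⁺ (proj₂ (VC.pairsInK αβ∈V)) τ∈D
  WPair-∈J (from-D αβ∈V) =
    ∈-join⁺ SC.top∈K (proj₁ (VD.pairsInK αβ∈V)) , ∈-join⁺ SC.top∈K (proj₂ (VD.pairsInK αβ∈V))

  WPair-facet : ∀ {α β} → WPair (α , β) → α IsFacetOf β
  WPair-facet (from-C {τ = τ} αβ∈V _) = ⊔-facetˡ τ (VC.pairsFacet αβ∈V)
  WPair-facet (from-D αβ∈V) = ⊔-facetʳ SC.top (VD.pairsFacet αβ∈V)

  ∈ₚ-from-C : ∀ {α β τ ρ} → (α , β) ∈ SC.V → τ ∈ D → ρ ∈ₚ (α ⊔ τ , β ⊔ τ) →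
              πᶜ ρ ∈ₚ (α , β) × πᵈ ρ ≡ τ
  ∈ₚ-from-C αβ∈V τ∈D (inj₁ refl) = inj₁ (πᶜ-⊔ α∈C τ∈D) , πᵈ-⊔ α∈C τ∈D
    where α∈C = proj₁ (VC.pairsInK αβ∈V)
  ∈ₚ-from-C αβ∈V τ∈D (inj₂ refl) = inj₂ (πᶜ-⊔ β∈C τ∈D) , πᵈ-⊔ β∈C τ∈D
    where β∈C = proj₂ (VC.pairsInK αβ∈V)

  ∈ₚ-from-D : ∀ {α β ρ} → (α , β) ∈ SD.V → ρ ∈ₚ (SC.top ⊔ α , SC.top ⊔ β) →
              πᵈ ρ ∈ₚ (α , β) × πᶜ ρ ≡ SC.top
  ∈ₚ-from-D αβ∈V (inj₁ refl) = inj₁ (πᵈ-⊔ SC.top∈K α∈D) , πᶜ-⊔ SC.top∈K α∈D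
    where α∈D = proj₁ (VD.pairsInK αβ∈V)
  ∈ₚ-from-D αβ∈V (inj₂ refl) = inj₂ (πᵈ-⊔ SC.top∈K β∈D) , πᶜ-⊔ SC.top∈K β∈D
    where β∈D = proj₂ (VD.pairsInK αβ∈V)

  C-top∉ₚ : ∀ {αβ σ} → αβ ∈ SC.V → σ ≡ SC.top → ¬ σ ∈ₚ αβ
  C-top∉ₚ αβ∈V refl = unpaired⇒∉ₚ SC.top-unpaired αβ∈V

  WPair-atMostOne : ∀ {w w′ ρ} → WPair w → WPair w′ → ρ ∈ₚ w → ρ ∈ₚ w′ → w ≡ w′
  WPair-atMostOne (from-C αβ∈V τ∈D) (from-C αβ′∈V τ′∈D) ρ∈w ρ∈w′
    with ∈ₚ-from-C αβ∈V τ∈D ρ∈w | ∈ₚ-from-C αβ′∈V τ′∈D ρ∈w′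
  ... | πᶜρ∈αβ , πᵈρ≡τ | πᶜρ∈αβ′ , πᵈρ≡τ′ =
    cong₂ (λ (α , β) τ → α ⊔ τ , β ⊔ τ)
      (VC.atMostOne αβ∈V αβ′∈V πᶜρ∈αβ πᶜρ∈αβ′) (trans (sym πᵈρ≡τ) πᵈρ≡τ′)
  WPair-atMostOne (from-C αβ∈V τ∈D) (from-D αβ′∈V) ρ∈w ρ∈w′ =
    ⊥-elim (C-top∉ₚ αβ∈V (proj₂ (∈ₚ-from-D αβ′∈V ρ∈w′)) (proj₁ (∈ₚ-from-C αβ∈V τ∈D ρ∈w)))
  WPair-atMostOne (from-D αβ∈V) (from-C αβ′∈V τ′∈D) ρ∈w ρ∈w′ =
    ⊥-elim (C-top∉ₚ αβ′∈V (proj₂ (∈ₚ-from-D αβ∈V ρ∈w)) (proj₁ (∈ₚ-from-C αβ′∈V τ′∈D ρ∈w′)))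
  WPair-atMostOne (from-D αβ∈V) (from-D αβ′∈V) ρ∈w ρ∈w′ =
    cong joinᵈ (VD.atMostOne αβ∈V αβ′∈V (proj₁ (∈ₚ-from-D αβ∈V ρ∈w)) (proj₁ (∈ₚ-from-D αβ′∈V ρ∈w′)))

  W-discrete : IsDiscreteVectorField (join C D) W
  W-discrete = record
    { pairsInK   = WPair-∈J ∘ W-pair
    ; pairsFacet = WPair-facet ∘ W-pair
    ; atMostOne  = λ w∈W w′∈W → WPair-atMostOne (W-pair w∈W) (W-pair w′∈W)
    }

  top : Simplex
  top = SC.top ⊔ SD.top

  top-length : length top ≡ suc (suc (p + q))
  top-length = length-⊔-top SC.top SD.top SC.top-length SD.top-length

  top-unpaired : Unpaired W top
  top-unpaired = ∉ₚ⇒unpaired (top∉ₚ ∘ W-pair)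
    where
    top∉ₚ : ∀ {w} → WPair w → ¬ top ∈ₚ w
    top∉ₚ (from-C αβ∈V τ∈D) top∈w =
      C-top∉ₚ αβ∈V (πᶜ-⊔ SC.top∈K SD.top∈K) (proj₁ (∈ₚ-from-C αβ∈V τ∈D top∈w))
    top∉ₚ (from-D αβ∈V) top∈w =
      unpaired⇒∉ₚ SD.top-unpaired αβ∈V
        (subst (_∈ₚ _) (πᵈ-⊔ SC.top∈K SD.top∈K) (proj₁ (∈ₚ-from-D αβ∈V top∈w)))

  top-critical : Critical (join C D) W top
  top-critical = ∈-join⁺ SC.top∈K SD.top∈K , length≡1+⇒≢[] top-length , inj₁ top-unpaired

  base-vertex : length SC.base ≡ 1
  base-vertex = sym (proj₂ (VC.pairsFacet SC.base-paired))

  base-paired : ([] , SC.base) ∈ W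
  base-paired = subst (λ β → ([] , β) ∈ W) (⊔-identityʳ SC.base)
    (from-C∈W SC.base-paired ([]∈ (IsPseudomanifold.complex SD.pseudomanifold)))

  base-critical : Critical (join C D) W SC.base
  base-critical =
    proj₂ (WPair-∈J (W-pair base-paired)) , length≡1+⇒≢[] base-vertex , inj₂ (base-vertex , base-paired)

  ∅-partner : ∀ {w} → WPair w → proj₁ w ≡ [] → proj₂ w ≡ SC.base
  ∅-partner (from-C {α} {β} {τ} αβ∈V _) α⊔τ≡[] with ⊔≡[]⇒ˡ α τ α⊔τ≡[] | ⊔≡[]⇒ʳ α τ α⊔τ≡[]
  ... | refl | refl =
    trans (⊔-identityʳ β) (cong proj₂ (VC.atMostOne αβ∈V SC.base-paired (inj₁ refl) (inj₁ refl)))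
  ∅-partner (from-D {α} _) top⊔α≡[] = ⊥-elim (length≡1+⇒≢[] SC.top-length (⊔≡[]⇒ˡ SC.top α top⊔α≡[]))

  πᶜ-unpaired : ∀ {σ} → σ ∈ join C D → Unpaired W σ → Unpaired SC.V (πᶜ σ)
  πᶜ-unpaired σ∈J σ-unpaired = ∉ₚ⇒unpaired λ αβ∈V πᶜσ∈αβ →
    unpaired⇒∉ₚ σ-unpaired (from-C∈W αβ∈V (πᵈ∈D σ∈J))
      (Sum.map (λ πᶜσ≡α → join-≡ σ∈J πᶜσ≡α refl) (λ πᶜσ≡β → join-≡ σ∈J πᶜσ≡β refl) πᶜσ∈αβ)

  πᵈ-unpaired : ∀ {σ} → σ ∈ join C D → πᶜ σ ≡ SC.top → Unpaired W σ → Unpaired SD.V (πᵈ σ)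
  πᵈ-unpaired σ∈J πᶜσ≡top σ-unpaired = ∉ₚ⇒unpaired λ αβ∈V πᵈσ∈αβ →
    unpaired⇒∉ₚ σ-unpaired (from-D∈W αβ∈V)
      (Sum.map (join-≡ σ∈J πᶜσ≡top) (join-≡ σ∈J πᶜσ≡top) πᵈσ∈αβ)

  critical⇒top∨base : ∀ {σ} → Critical (join C D) W σ → σ ≡ top ⊎ σ ≡ SC.base
  critical⇒top∨base (_ , _ , inj₂ (_ , ∅σ∈W)) = inj₂ (∅-partner (W-pair ∅σ∈W) refl)
  critical⇒top∨base (σ∈J , _ , inj₁ σ-unpaired) = inj₁ (join-≡ σ∈J πᶜσ≡top πᵈσ≡top)
    where
    πᶜσ≡top = SC.unpaired⇒top (πᶜ∈C σ∈J) (πᶜ-unpaired σ∈J σ-unpaired)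
    πᵈσ≡top = SD.unpaired⇒top (πᵈ∈D σ∈J) (πᵈ-unpaired σ∈J πᶜσ≡top σ-unpaired)

  data Step (ρ ρ′ : Simplex) : Set where
    within-C : ∀ {α β} → (α , β) ∈ SC.V → α IsFacetOf πᶜ ρ → πᶜ ρ ≢ β → πᶜ ρ′ ≡ β → Step ρ ρ′
    grows-C  : ∀ {α β} → (α , β) ∈ SC.V → length (πᶜ ρ) < length (πᶜ ρ′) → πᶜ ρ′ ≡ β → Step ρ ρ′
    within-D : ∀ {α β} → (α , β) ∈ SD.V → πᶜ ρ ≡ SC.top → πᶜ ρ′ ≡ SC.top →
               α IsFacetOf πᵈ ρ → πᵈ ρ ≢ β → πᵈ ρ′ ≡ β → Step ρ ρ′

  step-from-C : ∀ {ρ α β τ} → ρ ∈ join C D → (α , β) ∈ SC.V → τ ∈ D →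
                (α ⊔ τ) IsFacetOf ρ → ρ ≢ β ⊔ τ → Step ρ (β ⊔ τ)
  step-from-C {ρ} {α} {β} {τ} ρ∈J αβ∈V τ∈D (α⊔τ⊆ρ , α⊔τ<ρ) ρ≢β⊔τ = by-cases (m≤n⇒m<n∨m≡n α≤πᶜρ)
    where
    α∈C = proj₁ (VC.pairsInK αβ∈V)
    πᶜβ⊔τ≡β = πᶜ-⊔ (proj₂ (VC.pairsInK αβ∈V)) τ∈D
    α⊆πᶜρ : α ⊆ πᶜ ρ
    α⊆πᶜρ = subst (_⊆ πᶜ ρ) (πᶜ-⊔ α∈C τ∈D) (πᶜ-mono α⊔τ⊆ρ)
    τ⊆πᵈρ : τ ⊆ πᵈ ρ
    τ⊆πᵈρ = subst (_⊆ πᵈ ρ) (πᵈ-⊔ α∈C τ∈D) (πᵈ-mono α⊔τ⊆ρ)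
    α≤πᶜρ = ⊆⇒length≤ (C-increasing α∈C) (C-increasing (πᶜ∈C ρ∈J)) α⊆πᶜρ
    τ≤πᵈρ = ⊆⇒length≤ (D-increasing τ∈D) (D-increasing (πᵈ∈D ρ∈J)) τ⊆πᵈρ
    by-cases : length α < length (πᶜ ρ) ⊎ length α ≡ length (πᶜ ρ) → Step ρ (β ⊔ τ)
    by-cases (inj₂ α≡πᶜρ) =
      grows-C αβ∈V (≤-trans (s≤s (≤-reflexive (sym α≡πᶜρ))) (≤-reflexive β-length)) πᶜβ⊔τ≡β
      where
      β-length : suc (length α) ≡ length (πᶜ (β ⊔ τ))
      β-length = trans (proj₂ (VC.pairsFacet αβ∈V)) (cong length (sym πᶜβ⊔τ≡β))
    by-cases (inj₁ α<πᶜρ) = within-C αβ∈V (α⊆πᶜρ , proj₁ tight) πᶜρ≢β πᶜβ⊔τ≡β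
      where
      tight = bounded-sum-tight α<πᶜρ τ≤πᵈρ
        (trans (cong suc (sym (length-⊔ α τ))) (trans α⊔τ<ρ (join-length ρ∈J)))
      τ≡πᵈρ = ⊆∧length≥⇒≡ (D-increasing τ∈D) (D-increasing (πᵈ∈D ρ∈J)) τ⊆πᵈρ
        (≤-reflexive (sym (proj₂ tight)))
      πᶜρ≢β : πᶜ ρ ≢ β
      πᶜρ≢β πᶜρ≡β = ρ≢β⊔τ (join-≡ ρ∈J πᶜρ≡β (sym τ≡πᵈρ))

  step-from-D : ∀ {ρ α β} → ρ ∈ join C D → (α , β) ∈ SD.V →
                (SC.top ⊔ α) IsFacetOf ρ → ρ ≢ SC.top ⊔ β → Step ρ (SC.top ⊔ β)
  step-from-D {ρ} {α} {β} ρ∈J αβ∈V (top⊔α⊆ρ , top⊔α<ρ) ρ≢top⊔β =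
    within-D αβ∈V (sym top≡πᶜρ) (πᶜ-⊔ SC.top∈K β∈D) (α⊆πᵈρ , πᵈρ-length)
      (λ πᵈρ≡β → ρ≢top⊔β (join-≡ ρ∈J (sym top≡πᶜρ) πᵈρ≡β)) (πᵈ-⊔ SC.top∈K β∈D)
    where
    α∈D = proj₁ (VD.pairsInK αβ∈V)
    β∈D = proj₂ (VD.pairsInK αβ∈V)
    top≡πᶜρ : SC.top ≡ πᶜ ρ
    top≡πᶜρ = top⊆πᶜ⇒≡ ρ∈J SC.top∈K SC.top-length (subst (_⊆ πᶜ ρ) (πᶜ-⊔ SC.top∈K α∈D) (πᶜ-mono top⊔α⊆ρ))
    α⊆πᵈρ : α ⊆ πᵈ ρ
    α⊆πᵈρ = subst (_⊆ πᵈ ρ) (πᵈ-⊔ SC.top∈K α∈D) (πᵈ-mono top⊔α⊆ρ)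
    πᵈρ-length : suc (length α) ≡ length (πᵈ ρ)
    πᵈρ-length = +-cancelˡ-≡ (length SC.top) _ _ (begin
      length SC.top + suc (length α)  ≡⟨ +-suc (length SC.top) (length α) ⟩
      suc (length SC.top + length α)  ≡⟨ cong suc (length-⊔ SC.top α) ⟨
      suc (length (SC.top ⊔ α))       ≡⟨ top⊔α<ρ ⟩
      length ρ                        ≡⟨ join-length ρ∈J ⟩
      length (πᶜ ρ) + length (πᵈ ρ)   ≡⟨ cong (λ σ → length σ + length (πᵈ ρ)) top≡πᶜρ ⟨
      length SC.top + length (πᵈ ρ)   ∎)
      where open ≡-Reasoning

  classify : ∀ {ρ α β} → ρ ∈ join C D → (α , β) ∈ W → α IsFacetOf ρ → ρ ≢ β → Step ρ β
  classify {ρ} ρ∈J w∈W = by-origin (W-pair w∈W)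
    where
    by-origin : ∀ {α β} → WPair (α , β) → α IsFacetOf ρ → ρ ≢ β → Step ρ β
    by-origin (from-C αβ∈V τ∈D) = step-from-C ρ∈J αβ∈V τ∈D
    by-origin (from-D αβ∈V) = step-from-D ρ∈J αβ∈V

  target∈J : ∀ {α β} → (α , β) ∈ W → β ∈ join C D
  target∈J = proj₂ ∘ WPair-∈J ∘ W-pair

  end∈J : ∀ {ρ ρ′} → Trajectory W ρ ρ′ → ρ ∈ join C D → ρ′ ∈ join C D
  end∈J (stop _) ρ∈J = ρ∈J
  end∈J (step w∈W _ _ rest) _ = end∈J rest (target∈J w∈W)

  paired≢top : ∀ {α β σ} → (α , β) ∈ SC.V → σ ≡ β → σ ≢ SC.top
  paired≢top αβ∈V σ≡β σ≡top = proj₂ (SC.top-unpaired αβ∈V) (trans (sym σ≡top) σ≡β)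

  length-within-C : ∀ {α β σ σ′} → (α , β) ∈ SC.V → α IsFacetOf σ → σ′ ≡ β → length σ ≡ length σ′
  length-within-C αβ∈V (_ , α<σ) refl = trans (sym α<σ) (proj₂ (VC.pairsFacet αβ∈V))

  πᶜ-length-mono : ∀ {ρ ρ′} → Trajectory W ρ ρ′ → ρ ∈ join C D → length (πᶜ ρ) ≤ length (πᶜ ρ′)
  πᶜ-length-mono (stop _) _ = ≤-refl
  πᶜ-length-mono (step w∈W α⊂ρ ρ≢β rest) ρ∈J
    with classify ρ∈J w∈W α⊂ρ ρ≢β | πᶜ-length-mono rest (target∈J w∈W)
  ... | within-C αβ∈V α⊂πᶜρ _ πᶜβ≡β′ | β≤ρ′ =
    ≤-trans (≤-reflexive (length-within-C αβ∈V α⊂πᶜρ πᶜβ≡β′)) β≤ρ′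
  ... | grows-C _ ρ<β _ | β≤ρ′ = ≤-trans (<⇒≤ ρ<β) β≤ρ′
  ... | within-D _ πᶜρ≡top πᶜβ≡top _ _ _ | β≤ρ′ =
    ≤-trans (≤-reflexive (cong length (trans πᶜρ≡top (sym πᶜβ≡top)))) β≤ρ′

  stays-off-top : ∀ {ρ ρ′} → Trajectory W ρ ρ′ → ρ ∈ join C D → πᶜ ρ ≢ SC.top → πᶜ ρ′ ≢ SC.top
  stays-off-top (stop _) _ off = off
  stays-off-top (step w∈W α⊂ρ ρ≢β rest) ρ∈J off with classify ρ∈J w∈W α⊂ρ ρ≢β
  ... | within-C αβ∈V _ _ πᶜβ≡β′ = stays-off-top rest (target∈J w∈W) (paired≢top αβ∈V πᶜβ≡β′)
  ... | grows-C αβ∈V _ πᶜβ≡β′ = stays-off-top rest (target∈J w∈W) (paired≢top αβ∈V πᶜβ≡β′)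
  ... | within-D _ πᶜρ≡top _ _ _ _ = ⊥-elim (off πᶜρ≡top)

  project-C : ∀ {ρ ρ′} → Trajectory W ρ ρ′ → ρ ∈ join C D → πᶜ ρ ≢ SC.top →
              length (πᶜ ρ) ≡ length (πᶜ ρ′) → Trajectory SC.V (πᶜ ρ) (πᶜ ρ′)
  project-C (stop _) _ _ _ = stop _
  project-C {ρ′ = ρ′} (step w∈W α⊂ρ ρ≢β rest) ρ∈J off ρ≈ρ′ with classify ρ∈J w∈W α⊂ρ ρ≢β
  ... | within-C αβ∈V α⊂πᶜρ πᶜρ≢β′ πᶜβ≡β′ =
    step αβ∈V α⊂πᶜρ πᶜρ≢β′ (subst (λ σ → Trajectory SC.V σ (πᶜ ρ′)) πᶜβ≡β′
      (project-C rest (target∈J w∈W) (paired≢top αβ∈V πᶜβ≡β′)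
        (trans (sym (length-within-C αβ∈V α⊂πᶜρ πᶜβ≡β′)) ρ≈ρ′)))
  ... | grows-C _ ρ<β _ = ⊥-elim (<-irrefl ρ≈ρ′ (<-≤-trans ρ<β (πᶜ-length-mono rest (target∈J w∈W))))
  ... | within-D _ πᶜρ≡top _ _ _ _ = ⊥-elim (off πᶜρ≡top)

  project-D : ∀ {ρ ρ′} → Trajectory W ρ ρ′ → ρ ∈ join C D → πᶜ ρ ≡ SC.top → πᶜ ρ′ ≡ SC.top →
              Trajectory SD.V (πᵈ ρ) (πᵈ ρ′)
  project-D (stop _) _ _ _ = stop _
  project-D {ρ′ = ρ′} (step w∈W α⊂ρ ρ≢β rest) ρ∈J _ πᶜρ′≡top with classify ρ∈J w∈W α⊂ρ ρ≢β
  ... | within-C αβ∈V _ _ πᶜβ≡β′ =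
    ⊥-elim (stays-off-top rest (target∈J w∈W) (paired≢top αβ∈V πᶜβ≡β′) πᶜρ′≡top)
  ... | grows-C αβ∈V _ πᶜβ≡β′ =
    ⊥-elim (stays-off-top rest (target∈J w∈W) (paired≢top αβ∈V πᶜβ≡β′) πᶜρ′≡top)
  ... | within-D αβ∈V _ πᶜβ≡top α⊂πᵈρ πᵈρ≢β′ πᵈβ≡β′ =
    step αβ∈V α⊂πᵈρ πᵈρ≢β′ (subst (λ τ → Trajectory SD.V τ (πᵈ ρ′)) πᵈβ≡β′
      (project-D rest (target∈J w∈W) πᶜβ≡top πᶜρ′≡top))

  join-gradient : IsGradient W
  join-gradient ρ (step w∈W α⊂ρ ρ≢β rest) = closes (classify ρ∈J w∈W α⊂ρ ρ≢β)
    where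
    β∈J = target∈J w∈W
    ρ∈J = end∈J rest β∈J
    closes : Step ρ _ → ⊥
    closes (within-C αβ∈V α⊂πᶜρ πᶜρ≢β′ πᶜβ≡β′) =
      SC.gradient (πᶜ ρ) (step αβ∈V α⊂πᶜρ πᶜρ≢β′ (subst (λ σ → Trajectory SC.V σ (πᶜ ρ)) πᶜβ≡β′
        (project-C rest β∈J (paired≢top αβ∈V πᶜβ≡β′) (sym (length-within-C αβ∈V α⊂πᶜρ πᶜβ≡β′)))))
    closes (grows-C _ ρ<β _) = <-irrefl refl (<-≤-trans ρ<β (πᶜ-length-mono rest β∈J))
    closes (within-D αβ∈V πᶜρ≡top πᶜβ≡top α⊂πᵈρ πᵈρ≢β′ πᵈβ≡β′) =
      SD.gradient (πᵈ ρ) (step αβ∈V α⊂πᵈρ πᵈρ≢β′ (subst (λ τ → Trajectory SD.V τ (πᵈ ρ)) πᵈβ≡β′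
        (project-D rest β∈J πᶜβ≡top πᶜρ≡top)))

  join-sphere : IsCombinatorialSphereOfDim (join C D) (suc (p + q))
  join-sphere = record
    { pseudomanifold = join-pseudomanifold
    ; field'         = W
    ; discrete       = W-discrete
    ; gradient       = join-gradient
    ; top            = top
    ; bottom         = SC.base
    ; topCrit        = top-critical
    ; bottomCrit     = base-critical
    ; topDim         = top-length
    ; bottomDim      = base-vertex
    ; distinct       = λ top≡base →
                         1+n≢0 (suc-injective (trans (sym top-length) (trans (cong length top≡base) base-vertex)))
    ; onlyTwo        = critical⇒top∨base
    }

proposition4p12 : ∀ (C D : Complex) → IsCombinatorialSphere C → IsCombinatorialSphere D →
    DisjointVertices C D → IsCombinatorialSphere (join C D)
proposition4p12 C D (p , C-sphere) (q , D-sphere) disjoint =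
  suc (p + q) , JoinField.join-sphere (sphere⇒augmented C-sphere) (sphere⇒augmented D-sphere) disjoint
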